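{- For every integer $n\ge0$, let $$\mathcal F(n)=\#\{g\in\{0,\dots,n\}: 6g+5 \text{ is a Fermat prime}\}.$$ Define $$Q(n,g,v,a,b)=(n-g-v)^2+\big[12^{3g+2}-a(3g+2)\big]^2+\big[12^{3g+2}+1-b(6g+5)\big]^2 .$$ Then, for every integer $n\ge0$, $\mathcal F(n)$ equals the cardinality of the set $$\{(g,v,a,b)\in\mathbb N^4: Q(n,g,v,a,b)=0\}.$$
   Context: $\mathbb N=\{0,1,2,\dots\}$. A Fermat prime is a prime of the form $2^{2^k}+1$ with $k\ge0$. Subtraction in $Q$ is ordinary integer subtraction. -}

module Defs where

open import Data.Nat using (ℕ; zero; suc; _+_; _*_; _^_; _≤_; _<_; z≤n; s≤s; _≟_)
open import Data.Nat.Properties using (≤-trans; <-≤-trans; ^-monoʳ-≤; m≤m+n; +-mono-≤; ≤-refl; n≤1+n; m≤n+m; m<m+n)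
open import Data.Nat.Primality using (Prime; prime?)
open import Data.Fin using (Fin; toℕ; fromℕ<)
open import Data.Fin.Properties using (any?; toℕ-fromℕ<)
open import Data.Product using (Σ; ∃; ∃-syntax; _×_; _,_)
open import Data.List using (List; length; filter; upTo)
open import Data.Integer using (ℤ; +_; _-_) renaming (_+_ to _+ℤ_; _*_ to _*ℤ_)
open import Relation.Nullary using (Dec; yes; no)
open import Relation.Nullary.Decidable using (_×-dec_)
open import Relation.Binary.PropositionalEquality using (_≡_; refl; subst; sym)

FermatPrime : ℕ → Set
FermatPrime p = Prime p × ∃[ k ] p ≡ 2 ^ (2 ^ k) + 1

private
  n<2^n : ∀ n → n < 2 ^ n
  n<2^n zero = s≤s z≤n
  n<2^n (suc n) = ≤-trans (s≤s (n<2^n n)) (m<m+n (2 ^ n) (≤-trans (≤-trans (s≤s z≤n) (n<2^n n)) (m≤m+n (2 ^ n) 0)))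

  k<F : ∀ k → k < 2 ^ (2 ^ k) + 1
  k<F k = ≤-trans (<-≤-trans (n<2^n k) (^-monoʳ-≤ 2 (≤-trans (n≤1+n k) (n<2^n k))))
                  (m≤m+n (2 ^ (2 ^ k)) 1)

  fermatForm? : ∀ p → Dec (∃[ k ] p ≡ 2 ^ (2 ^ k) + 1)
  fermatForm? p with any? {n = p} (λ i → p ≟ 2 ^ (2 ^ toℕ i) + 1)
  ... | yes (i , e) = yes (toℕ i , e)
  ... | no ¬e = no λ { (k , refl) →
          ¬e (fromℕ< (k<F k) , subst (λ j → 2 ^ (2 ^ k) + 1 ≡ 2 ^ (2 ^ j) + 1) (sym (toℕ-fromℕ< (k<F k))) refl) }

fermatPrime? : ∀ p → Dec (FermatPrime p)
fermatPrime? p = prime? p ×-dec fermatForm? p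

𝓕 : ℕ → ℕ
𝓕 n = length (filter (λ g → fermatPrime? (6 * g + 5)) (upTo (suc n)))

Q : ℕ → ℕ → ℕ → ℕ → ℕ → ℤ
Q n g v a b =
  let x = + n - + g - + v
      y = + (12 ^ (3 * g + 2)) - + (a * (3 * g + 2))
      z = + (12 ^ (3 * g + 2) + 1) - + (b * (6 * g + 5))
  in x *ℤ x +ℤ y *ℤ y +ℤ z *ℤ z

module Submission where

-- Write e = 3g + 2 and p = 6g + 5 = 2e + 1.  Q vanishes exactly when v = n − g, e ∣ 12ᵉ and
-- p ∣ 12ᵉ + 1, so it suffices to show that p is a Fermat prime iff e ∣ 12ᵉ and p ∣ 12ᵉ + 1.
--
-- If p = 2^(2ᵏ) + 1 is prime, then e is a power of two, so e ∣ 12ᵉ.  Moreover p ≡ 1 (mod 4) and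
-- p ≡ 2 (mod 3), which makes 12 a quadratic non-residue modulo p: in ℤ[ω]/p the Frobenius sends
-- √−3 = 1 + 2ω to its negative.  Hence 12ᵉ = 12^((p − 1)/2) ≡ −1 (mod p).
--
-- Conversely, e ∣ 12ᵉ and 3 ∤ e force e = 2ᵗ, so p = 2^(t+1) + 1 divides 12^(2ᵗ) + 1.  Modulo any
-- prime factor q of 12^(2ᵗ) + 1 the order of 12 is 2^(t+1), so q ≥ 2^(t+1) + 1 = p; thus p is
-- prime, and a prime of the form 2ˢ + 1 has s a power of two.

open import Algebra.Bundles using (CommutativeSemiring)
open import Data.Nat using (ℕ)
open import Data.Nat.Primality using (Prime)

module IntegerCongruence where

  open import Data.Nat as ℕ using (zero; suc)
  import Data.Nat.Divisibility as ℕ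
  open import Data.Nat.Primality using (euclidsLemma)
  open import Data.Integer using (ℤ; +_; _+_; _*_; -_; _-_; _^_; 0ℤ; 1ℤ; -1ℤ; ∣_∣)
  open import Data.Integer.Properties
    using (pos-+; pos-*; +-identityʳ; *-identityʳ; abs-*; ^-*-assoc; ^-zeroˡ; ^-distribˡ-+-*)
  import Data.Nat.Properties as ℕP
  open import Data.Nat.GCD using (gcd; gcd-GCD; module Bézout)
  open import Data.Integer.Divisibility.Signed
    using (_∣_; divides; ∣m∣n⇒∣m+n; ∣m∣n⇒∣m-n; ∣m⇒∣-m; ∣n⇒∣m*n; ∣⇒∣ᵤ; ∣ᵤ⇒∣)
  open import Data.Integer.Tactic.RingSolver using (solve-∀)
  open import Data.Sum using (inj₁; inj₂)
  open import Relation.Binary.Bundles using (Setoid)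
  import Relation.Binary.Reasoning.Setoid
  open import Relation.Binary.PropositionalEquality using (_≡_; refl; sym; trans; cong; subst)
  open import Relation.Nullary using (contradiction)
  open import Level using (0ℓ)

  pos-^ : ∀ a n → + (a ℕ.^ n) ≡ (+ a) ^ n
  pos-^ a zero    = refl
  pos-^ a (suc n) = trans (pos-* a (a ℕ.^ n)) (cong (+ a *_) (pos-^ a n))

  ^-distribʳ-* : ∀ a b n → (a * b) ^ n ≡ a ^ n * b ^ n
  ^-distribʳ-* a b zero    = refl
  ^-distribʳ-* a b (suc n) =
    trans (cong ((a * b) *_) (^-distribʳ-* a b n)) (lemma a b (a ^ n) (b ^ n))
    where
    lemma : ∀ a b x y → (a * b) * (x * y) ≡ (a * x) * (b * y)
    lemma = solve-∀

  -- A record rather than a synonym for + m ∣ x - y, so that x, y and m are inferable.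
  infix 4 _≡_mod_
  record _≡_mod_ (x y : ℤ) (m : ℕ) : Set where
    constructor congruent
    field divides-difference : + m ∣ x - y
  open _≡_mod_ public

  module _ {m : ℕ} where

    ≡-mod-reflexive : ∀ {x y} → x ≡ y → x ≡ y mod m
    ≡-mod-reflexive {x} refl = congruent (divides 0ℤ (x-x≡0*x x))
      where
      x-x≡0*x : ∀ x → x - x ≡ 0ℤ * x
      x-x≡0*x = solve-∀

    ≡-mod-refl : ∀ {x} → x ≡ x mod m
    ≡-mod-refl = ≡-mod-reflexive refl

    ≡-mod-sym : ∀ {x y} → x ≡ y mod m → y ≡ x mod m
    ≡-mod-sym {x} {y} (congruent m∣x-y) = congruent (subst (+ m ∣_) (lemma x y) (∣m⇒∣-m m∣x-y))
      where
      lemma : ∀ x y → - (x - y) ≡ y - x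
      lemma = solve-∀

    ≡-mod-trans : ∀ {x y z} → x ≡ y mod m → y ≡ z mod m → x ≡ z mod m
    ≡-mod-trans {x} {y} {z} (congruent m∣x-y) (congruent m∣y-z) =
      congruent (subst (+ m ∣_) (lemma x y z) (∣m∣n⇒∣m+n m∣x-y m∣y-z))
      where
      lemma : ∀ x y z → (x - y) + (y - z) ≡ x - z
      lemma = solve-∀

  ≡-mod-setoid : ℕ → Setoid 0ℓ 0ℓ
  ≡-mod-setoid m = record
    { _≈_ = _≡_mod m
    ; isEquivalence = record { refl = ≡-mod-refl ; sym = ≡-mod-sym ; trans = ≡-mod-trans }
    }

  module ≡-mod-Reasoning (m : ℕ) = Relation.Binary.Reasoning.Setoid (≡-mod-setoid m)

  module _ {m : ℕ} where

    private
      via : ∀ {a b} → a ≡ b → + m ∣ a → + m ∣ b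
      via = subst (+ m ∣_)

    +-cong-mod : ∀ {x x′ y y′} → x ≡ x′ mod m → y ≡ y′ mod m → x + y ≡ x′ + y′ mod m
    +-cong-mod {x} {x′} {y} {y′} (congruent p) (congruent q) =
      congruent (via (lemma x x′ y y′) (∣m∣n⇒∣m+n p q))
      where
      lemma : ∀ x x′ y y′ → (x - x′) + (y - y′) ≡ (x + y) - (x′ + y′)
      lemma = solve-∀

    -‿cong-mod : ∀ {x x′ y y′} → x ≡ x′ mod m → y ≡ y′ mod m → x - y ≡ x′ - y′ mod m
    -‿cong-mod {x} {x′} {y} {y′} (congruent p) (congruent q) =
      congruent (via (lemma x x′ y y′) (∣m∣n⇒∣m-n p q))
      where
      lemma : ∀ x x′ y y′ → (x - x′) - (y - y′) ≡ (x - y) - (x′ - y′)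
      lemma = solve-∀

    *-cong-mod : ∀ {x x′ y y′} → x ≡ x′ mod m → y ≡ y′ mod m → x * y ≡ x′ * y′ mod m
    *-cong-mod {x} {x′} {y} {y′} (congruent p) (congruent q) =
      congruent (via (lemma x x′ y y′) (∣m∣n⇒∣m+n (∣n⇒∣m*n y p) (∣n⇒∣m*n x′ q)))
      where
      lemma : ∀ x x′ y y′ → y * (x - x′) + x′ * (y - y′) ≡ x * y - x′ * y′
      lemma = solve-∀

    ^-cong-mod : ∀ {x y} n → x ≡ y mod m → x ^ n ≡ y ^ n mod m
    ^-cong-mod zero    x≡y = ≡-mod-refl
    ^-cong-mod (suc n) x≡y = *-cong-mod x≡y (^-cong-mod n x≡y)

    ∣⇒≡0-mod : ∀ {a} → m ℕ.∣ a → + a ≡ 0ℤ mod m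
    ∣⇒≡0-mod {a} m∣a = congruent (via (sym (+-identityʳ (+ a))) (∣ᵤ⇒∣ m∣a))

    ≡0-mod⇒∣ : ∀ {a} → + a ≡ 0ℤ mod m → m ℕ.∣ a
    ≡0-mod⇒∣ {a} (congruent m∣a-0) = ∣⇒∣ᵤ (via (+-identityʳ (+ a)) m∣a-0)

    m*x≡0-mod : ∀ x → + m * x ≡ 0ℤ mod m
    m*x≡0-mod x = congruent (divides x (lemma (+ m) x))
      where
      lemma : ∀ m x → m * x - 0ℤ ≡ x * m
      lemma = solve-∀

    ∣+1⇒≡-1-mod : ∀ {b} → m ℕ.∣ b ℕ.+ 1 → + b ≡ -1ℤ mod m
    ∣+1⇒≡-1-mod {b} m∣b+1 = begin
      + b                 ≡⟨ lemma (+ b) ⟩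
      (+ b + 1ℤ) + -1ℤ    ≡⟨ cong (_+ -1ℤ) (pos-+ b 1) ⟨
      + (b ℕ.+ 1) + -1ℤ   ≈⟨ +-cong-mod (∣⇒≡0-mod m∣b+1) (≡-mod-refl {x = -1ℤ}) ⟩
      0ℤ + -1ℤ            ≡⟨⟩
      -1ℤ                 ∎
      where
      open ≡-mod-Reasoning m
      lemma : ∀ x → x ≡ (x + 1ℤ) + -1ℤ
      lemma = solve-∀

    ≡-1-mod⇒∣+1 : ∀ {b} → + b ≡ -1ℤ mod m → m ℕ.∣ b ℕ.+ 1
    ≡-1-mod⇒∣+1 {b} b≡-1 = ≡0-mod⇒∣ (begin
      + (b ℕ.+ 1)  ≡⟨ pos-+ b 1 ⟩
      + b + 1ℤ     ≈⟨ +-cong-mod b≡-1 (≡-mod-refl {x = 1ℤ}) ⟩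
      -1ℤ + 1ℤ     ≡⟨⟩
      0ℤ           ∎)
      where open ≡-mod-Reasoning m

    ^≡1⇒^*≡1 : ∀ {x A} → x ^ A ≡ 1ℤ mod m → ∀ n → x ^ (A ℕ.* n) ≡ 1ℤ mod m
    ^≡1⇒^*≡1 {x} {A} xᴬ≡1 n = begin
      x ^ (A ℕ.* n) ≡⟨ ^-*-assoc x A n ⟨
      (x ^ A) ^ n   ≈⟨ ^-cong-mod n xᴬ≡1 ⟩
      1ℤ ^ n        ≡⟨ ^-zeroˡ n ⟩
      1ℤ            ∎
      where open ≡-mod-Reasoning m

    private
      bézout⇒^≡1 : ∀ {x d A B u v} → x ^ A ≡ 1ℤ mod m → x ^ B ≡ 1ℤ mod m →
                   d ℕ.+ v ℕ.* B ≡ u ℕ.* A → x ^ d ≡ 1ℤ mod m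
      bézout⇒^≡1 {x} {d} {A} {B} {u} {v} xᴬ≡1 xᴮ≡1 d+vB≡uA = begin
        x ^ d                     ≡⟨ *-identityʳ (x ^ d) ⟨
        x ^ d * 1ℤ                ≈⟨ *-cong-mod (≡-mod-refl {x = x ^ d}) xᴮᵛ≡1 ⟨
        x ^ d * x ^ (B ℕ.* v)     ≡⟨ ^-distribˡ-+-* x d (B ℕ.* v) ⟨
        x ^ (d ℕ.+ B ℕ.* v)       ≡⟨ cong (λ n → x ^ (d ℕ.+ n)) (ℕP.*-comm B v) ⟩
        x ^ (d ℕ.+ v ℕ.* B)       ≡⟨ cong (x ^_) (trans d+vB≡uA (ℕP.*-comm u A)) ⟩
        x ^ (A ℕ.* u)             ≈⟨ ^≡1⇒^*≡1 {x} {A} xᴬ≡1 u ⟩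
        1ℤ                        ∎
        where
        open ≡-mod-Reasoning m
        xᴮᵛ≡1 : x ^ (B ℕ.* v) ≡ 1ℤ mod m
        xᴮᵛ≡1 = ^≡1⇒^*≡1 {x} {B} xᴮ≡1 v

    ^≡1-gcd : ∀ {x A B} → x ^ A ≡ 1ℤ mod m → x ^ B ≡ 1ℤ mod m → x ^ gcd A B ≡ 1ℤ mod m
    ^≡1-gcd {x} {A} {B} xᴬ≡1 xᴮ≡1 with Bézout.identity (gcd-GCD A B)
    ... | Bézout.+- u v d+vB≡uA = bézout⇒^≡1 {x} {gcd A B} {A} {B} {u} {v} xᴬ≡1 xᴮ≡1 d+vB≡uA
    ... | Bézout.-+ u v d+uA≡vB = bézout⇒^≡1 {x} {gcd A B} {B} {A} {v} {u} xᴮ≡1 xᴬ≡1 d+uA≡vB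

  *-cancelˡ-mod : ∀ {p a x y} → Prime p → p ℕ.∤ ∣ a ∣ → a * x ≡ a * y mod p → x ≡ y mod p
  *-cancelˡ-mod {p} {a} {x} {y} p-prime p∤a (congruent p∣a[x-y])
    with euclidsLemma ∣ a ∣ ∣ x - y ∣ p-prime (subst (p ℕ.∣_) (abs-* a (x - y)) (∣⇒∣ᵤ p∣a*[x-y]))
    where
    lemma : ∀ a x y → a * x - a * y ≡ a * (x - y)
    lemma = solve-∀
    p∣a*[x-y] : + p ∣ a * (x - y)
    p∣a*[x-y] = subst (+ p ∣_) (lemma a x y) p∣a[x-y]
  ... | inj₁ p∣a     = contradiction p∣a p∤a
  ... | inj₂ p∣[x-y] = congruent (∣ᵤ⇒∣ p∣[x-y])

module EisensteinIntegers where

  open import Data.Integer using (ℤ; _+_; _*_; _-_; 0ℤ; 1ℤ)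
  import Data.Integer.Properties as ℤ
  open import Data.Integer.Tactic.RingSolver using (solve-∀)
  open import Data.Product using (_×_; _,_; proj₁; proj₂)
  open import Data.Product.Relation.Binary.Pointwise.NonDependent using (Pointwise; ×-isEquivalence)
  open import Algebra.Structures.Biased using (isCommutativeSemiringˡ)
  open import Level using (0ℓ)
  open import Relation.Binary.PropositionalEquality using (_≡_; cong; cong₂; trans)
  open import Relation.Binary.Bundles using (Setoid)
  open import Relation.Binary.Structures using (IsEquivalence)
  open IntegerCongruence

  -- (a , b) stands for a + bω, where ω² = −1 − ω.
  ℤ[ω] : Set
  ℤ[ω] = ℤ × ℤ

  infixl 6 _⊕_
  infixl 7 _⊗_

  _⊕_ : ℤ[ω] → ℤ[ω] → ℤ[ω]
  (a , b) ⊕ (c , d) = (a + c , b + d)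

  _⊗_ : ℤ[ω] → ℤ[ω] → ℤ[ω]
  (a , b) ⊗ (c , d) = (a * c - b * d , a * d + b * c - b * d)

  ι : ℤ → ℤ[ω]
  ι a = (a , 0ℤ)

  ω : ℤ[ω]
  ω = (0ℤ , 1ℤ)

  ⊕-assoc : ∀ x y z → (x ⊕ y) ⊕ z ≡ x ⊕ (y ⊕ z)
  ⊕-assoc (a , b) (c , d) (e , f) = cong₂ _,_ (ℤ.+-assoc a c e) (ℤ.+-assoc b d f)

  ⊕-comm : ∀ x y → x ⊕ y ≡ y ⊕ x
  ⊕-comm (a , b) (c , d) = cong₂ _,_ (ℤ.+-comm a c) (ℤ.+-comm b d)

  ⊕-identityˡ : ∀ x → ι 0ℤ ⊕ x ≡ x
  ⊕-identityˡ (a , b) = cong₂ _,_ (ℤ.+-identityˡ a) (ℤ.+-identityˡ b)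

  ⊗-assoc : ∀ x y z → (x ⊗ y) ⊗ z ≡ x ⊗ (y ⊗ z)
  ⊗-assoc (a , b) (c , d) (e , f) = cong₂ _,_ (re a b c d e f) (im a b c d e f)
    where
    re : ∀ a b c d e f →
         (a * c - b * d) * e - (a * d + b * c - b * d) * f ≡
         a * (c * e - d * f) - b * (c * f + d * e - d * f)
    re = solve-∀
    im : ∀ a b c d e f →
         (a * c - b * d) * f + (a * d + b * c - b * d) * e - (a * d + b * c - b * d) * f ≡
         a * (c * f + d * e - d * f) + b * (c * e - d * f) - b * (c * f + d * e - d * f)
    im = solve-∀

  ⊗-comm : ∀ x y → x ⊗ y ≡ y ⊗ x
  ⊗-comm (a , b) (c , d) = cong₂ _,_ (re a b c d) (im a b c d)
    where
    re : ∀ a b c d → a * c - b * d ≡ c * a - d * b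
    re = solve-∀
    im : ∀ a b c d → a * d + b * c - b * d ≡ c * b + d * a - d * b
    im = solve-∀

  ⊗-identityˡ : ∀ x → ι 1ℤ ⊗ x ≡ x
  ⊗-identityˡ (a , b) = cong₂ _,_ (re a b) (im a b)
    where
    re : ∀ a b → 1ℤ * a - 0ℤ * b ≡ a
    re = solve-∀
    im : ∀ a b → 1ℤ * b + 0ℤ * a - 0ℤ * b ≡ b
    im = solve-∀

  ⊗-zeroˡ : ∀ x → ι 0ℤ ⊗ x ≡ ι 0ℤ
  ⊗-zeroˡ (a , b) = cong₂ _,_ (re a b) (im a b)
    where
    re : ∀ a b → 0ℤ * a - 0ℤ * b ≡ 0ℤ
    re = solve-∀
    im : ∀ a b → 0ℤ * b + 0ℤ * a - 0ℤ * b ≡ 0ℤ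
    im = solve-∀

  ⊗-distribʳ-⊕ : ∀ x y z → (y ⊕ z) ⊗ x ≡ y ⊗ x ⊕ z ⊗ x
  ⊗-distribʳ-⊕ (a , b) (c , d) (e , f) = cong₂ _,_ (re a b c d e f) (im a b c d e f)
    where
    re : ∀ a b c d e f → (c + e) * a - (d + f) * b ≡ (c * a - d * b) + (e * a - f * b)
    re = solve-∀
    im : ∀ a b c d e f →
         (c + e) * b + (d + f) * a - (d + f) * b ≡ (c * b + d * a - d * b) + (e * b + f * a - f * b)
    im = solve-∀

  ι-⊗ : ∀ a b → ι a ⊗ ι b ≡ ι (a * b)
  ι-⊗ a b = cong₂ _,_ (re a b) (im a b)
    where
    re : ∀ a b → a * b - 0ℤ * 0ℤ ≡ a * b
    re = solve-∀
    im : ∀ a b → a * 0ℤ + 0ℤ * b - 0ℤ * 0ℤ ≡ 0ℤ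
    im = solve-∀

  ℤ[ω]/_ : ℕ → CommutativeSemiring 0ℓ 0ℓ
  ℤ[ω]/ m = record
    { Carrier = ℤ[ω]
    ; _≈_ = _≈_
    ; _+_ = _⊕_
    ; _*_ = _⊗_
    ; 0# = ι 0ℤ
    ; 1# = ι 1ℤ
    ; isCommutativeSemiring = isCommutativeSemiringˡ record
      { +-isCommutativeMonoid = record
        { isMonoid = record
          { isSemigroup = record
            { isMagma = record { isEquivalence = ≈-isEquivalence ; ∙-cong = ⊕-cong }
            ; assoc = λ x y z → ≈-reflexive (⊕-assoc x y z) }
          ; identity = (λ x → ≈-reflexive (⊕-identityˡ x)) , (λ x → ≈-reflexive (⊕-identityʳ x)) }
        ; comm = λ x y → ≈-reflexive (⊕-comm x y) }
      ; *-isCommutativeMonoid = record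
        { isMonoid = record
          { isSemigroup = record
            { isMagma = record { isEquivalence = ≈-isEquivalence ; ∙-cong = ⊗-cong }
            ; assoc = λ x y z → ≈-reflexive (⊗-assoc x y z) }
          ; identity = (λ x → ≈-reflexive (⊗-identityˡ x)) , (λ x → ≈-reflexive (⊗-identityʳ x)) }
        ; comm = λ x y → ≈-reflexive (⊗-comm x y) }
      ; distribʳ = λ x y z → ≈-reflexive (⊗-distribʳ-⊕ x y z)
      ; zeroˡ = λ x → ≈-reflexive (⊗-zeroˡ x) }
    }
    where
    infix 4 _≈_
    _≈_ : ℤ[ω] → ℤ[ω] → Set
    _≈_ = Pointwise (_≡_mod m) (_≡_mod m)

    ≈-isEquivalence : IsEquivalence _≈_
    ≈-isEquivalence = ×-isEquivalence ≡-mod-isEquivalence ≡-mod-isEquivalence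
      where open Setoid (≡-mod-setoid m) using () renaming (isEquivalence to ≡-mod-isEquivalence)

    ≈-reflexive : ∀ {x y} → x ≡ y → x ≈ y
    ≈-reflexive x≡y = ≡-mod-reflexive (cong proj₁ x≡y) , ≡-mod-reflexive (cong proj₂ x≡y)

    ⊕-cong : ∀ {x x′ y y′} → x ≈ x′ → y ≈ y′ → x ⊕ y ≈ x′ ⊕ y′
    ⊕-cong (a≡ , b≡) (c≡ , d≡) = +-cong-mod a≡ c≡ , +-cong-mod b≡ d≡

    ⊗-cong : ∀ {x x′ y y′} → x ≈ x′ → y ≈ y′ → x ⊗ y ≈ x′ ⊗ y′
    ⊗-cong (a≡ , b≡) (c≡ , d≡) =
      -‿cong-mod (*-cong-mod a≡ c≡) (*-cong-mod b≡ d≡) ,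
      -‿cong-mod (+-cong-mod (*-cong-mod a≡ d≡) (*-cong-mod b≡ c≡)) (*-cong-mod b≡ d≡)

    ⊕-identityʳ : ∀ x → x ⊕ ι 0ℤ ≡ x
    ⊕-identityʳ x = trans (⊕-comm x (ι 0ℤ)) (⊕-identityˡ x)

    ⊗-identityʳ : ∀ x → x ⊗ ι 1ℤ ≡ x
    ⊗-identityʳ x = trans (⊗-comm x (ι 1ℤ)) (⊗-identityˡ x)

module PrimeBinomial where

  open import Data.Nat using (zero; suc; _*_; _∸_; _<_; _!)
  open import Data.Nat.Properties using (<⇒≱; <⇒≤; <-trans; n<1+n; ∸-monoʳ-<; _!*_!≢0; *-comm)
  open import Data.Nat.Divisibility using (_∣_; _∤_; divides; ∣1⇒≡1; ∣⇒≤)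
  open import Data.Nat.DivMod using (m/n*n≡m)
  open import Data.Nat.Primality using (euclidsLemma; ¬prime[1])
  open import Data.Nat.Combinatorics using (_C_; k![n∸k]!∣n!)
  open import Data.Nat.Combinatorics.Specification using (nCk≡n!/k![n-k]!)
  open import Data.Sum using (inj₁; inj₂)
  open import Relation.Binary.PropositionalEquality using (_≡_; refl; sym; cong; trans; subst)
  open import Data.Empty using (⊥-elim)

  prime∤n! : ∀ {p n} → Prime p → n < p → p ∤ n !
  prime∤n! {n = zero}  p-prime n<p p∣1 with refl ← ∣1⇒≡1 p∣1 = ¬prime[1] p-prime
  prime∤n! {n = suc n} p-prime n<p p∣n! with euclidsLemma (suc n) (n !) p-prime p∣n!
  ... | inj₁ p∣1+n = <⇒≱ n<p (∣⇒≤ p∣1+n)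
  ... | inj₂ p∣n!  = prime∤n! p-prime (<-trans (n<1+n n) n<p) p∣n!

  prime∣pCk : ∀ {p k} → Prime p → 0 < k → k < p → p ∣ p C k
  prime∣pCk {p@(suc q)} {k} p-prime 0<k k<p
    with euclidsLemma (p C k) (k ! * (p ∸ k) !) p-prime (subst (p ∣_) (sym pCk*k!*[p∸k]!≡p!) p∣p!)
    where
    pCk*k!*[p∸k]!≡p! : (p C k) * (k ! * (p ∸ k) !) ≡ p !
    pCk*k!*[p∸k]!≡p! = trans (cong (_* (k ! * (p ∸ k) !)) (nCk≡n!/k![n-k]! (<⇒≤ k<p)))
                             (m/n*n≡m {{k !* (p ∸ k) !≢0}} (k![n∸k]!∣n! (<⇒≤ k<p)))
    p∣p! : p ∣ p !
    p∣p! = divides (q !) (*-comm p (q !))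
  ... | inj₁ p∣pCk = p∣pCk
  ... | inj₂ p∣k!*[p∸k]! with euclidsLemma (k !) ((p ∸ k) !) p-prime p∣k!*[p∸k]!
  ...   | inj₁ p∣k!     = ⊥-elim (prime∤n! p-prime k<p p∣k!)
  ...   | inj₂ p∣[p∸k]! = ⊥-elim (prime∤n! p-prime (∸-monoʳ-< 0<k (<⇒≤ k<p)) p∣[p∸k]!)

module FreshmansDream {c ℓ} (R : CommutativeSemiring c ℓ) where

  open CommutativeSemiring R hiding (zero; refl)
  open import Data.Nat as ℕ using (zero; suc; s≤s; z≤n)
  import Data.Nat.Properties as ℕP
  open import Data.Nat.Divisibility using (_∣_; divides)
  open import Data.Nat.Combinatorics using (nCn≡1)
  open import Data.Nat.Primality using (¬prime[0]; prime⇒nonZero)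
  open import Data.Fin as Fin using (Fin; toℕ; inject₁)
  open import Data.Fin.Properties using (toℕ-fromℕ; toℕ-inject₁; toℕ<n)
  open import Data.Vec.Functional using (init; last; tail)
  open import Data.Empty using (⊥-elim)
  open import Algebra.Properties.CommutativeSemiring.Binomial R using (theorem; binomialTerm)
  open import Algebra.Properties.Monoid.Sum +-monoid
    using (sum; sum-init-last; sum-cong-≋; sum-replicate-zero)
  open import Algebra.Properties.Monoid.Mult +-monoid using (_×_; ×-assocˡ; ×-congˡ)
  open import Algebra.Properties.Monoid.Mult *-monoid using (×-idem)
  open import Algebra.Properties.Semiring.Exp semiring using (_^_)
  open import Relation.Binary.PropositionalEquality using (refl)
  open import Relation.Binary.Reasoning.Setoid setoid
  open PrimeBinomial using (prime∣pCk)

  multiple×x≈0 : ∀ {p n} → (∀ x → p × x ≈ 0#) → p ∣ n → ∀ x → n × x ≈ 0#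
  multiple×x≈0 {p} p×x≈0 (divides q refl) x = begin
    (q ℕ.* p) × x  ≈⟨ ×-congˡ (ℕP.*-comm q p) ⟩
    (p ℕ.* q) × x  ≈⟨ ×-assocˡ x p q ⟨
    p × (q × x)    ≈⟨ p×x≈0 (q × x) ⟩
    0#             ∎

  freshman's-dream : ∀ {p} → Prime p → (∀ x → p × x ≈ 0#) → ∀ x y → (x + y) ^ p ≈ x ^ p + y ^ p
  freshman's-dream {zero}  p-prime _ _ _ = ⊥-elim (¬prime[0] p-prime)
  freshman's-dream {suc n} p-prime p×x≈0 x y = begin
    (x + y) ^ suc n                          ≈⟨ theorem (suc n) x y ⟩
    term Fin.zero + sum (tail term)          ≈⟨ +-cong first (sum-init-last (tail term)) ⟩
    y ^ suc n + (sum middle + last (tail term))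
                                             ≈⟨ +-congˡ (+-cong middle-sum≈0 last-term) ⟩
    y ^ suc n + (0# + x ^ suc n)             ≈⟨ +-congˡ (+-identityˡ _) ⟩
    y ^ suc n + x ^ suc n                    ≈⟨ +-comm _ _ ⟩
    x ^ suc n + y ^ suc n                    ∎
    where
    term : Fin (suc (suc n)) → Carrier
    term = binomialTerm x y (suc n)
    middle : Fin n → Carrier
    middle = init (tail term)

    first : term Fin.zero ≈ y ^ suc n
    first = trans (+-identityʳ _) (*-identityˡ _)
    last-term : last (tail term) ≈ x ^ suc n
    last-term rewrite toℕ-fromℕ n | nCn≡1 (suc n) | ℕP.n∸n≡0 n =
      trans (+-identityʳ _) (*-identityʳ _)
    middle-sum≈0 : sum middle ≈ 0#
    middle-sum≈0 = trans (sum-cong-≋ middle≈0) (sum-replicate-zero n)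
      where
      middle≈0 : ∀ i → middle i ≈ 0#
      middle≈0 i = multiple×x≈0 p×x≈0 (prime∣pCk p-prime (s≤s z≤n) (s≤s k<n)) _
        where
        k<n : toℕ (inject₁ i) ℕ.< n
        k<n rewrite toℕ-inject₁ i = toℕ<n i

  fermat : ∀ {p} → Prime p → (∀ x → p × x ≈ 0#) → ∀ n → (n × 1#) ^ p ≈ n × 1#
  fermat {p} p-prime p×x≈0 = go
    where
    idempotent⇒^p≈ : ∀ {x} → x * x ≈ x → x ^ p ≈ x
    idempotent⇒^p≈ x*x≈x = ×-idem x*x≈x p {{prime⇒nonZero p-prime}}

    go : ∀ n → (n × 1#) ^ p ≈ n × 1#
    go zero    = idempotent⇒^p≈ (zeroˡ 0#)
    go (suc n) = begin
      (1# + n × 1#) ^ p      ≈⟨ freshman's-dream p-prime p×x≈0 1# (n × 1#) ⟩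
      1# ^ p + (n × 1#) ^ p  ≈⟨ +-cong (idempotent⇒^p≈ (*-identityˡ 1#)) (go n) ⟩
      1# + n × 1#            ∎

module FermatLittle {p : ℕ} (p-prime : Prime p) where

  open import Data.Nat using (zero; suc; _∸_)
  import Data.Nat.Properties as ℕP
  open import Data.Nat.Divisibility using (_∤_)
  open import Data.Nat.Primality using (prime⇒nonZero)
  open import Data.Integer using (+_; _*_; _^_; 1ℤ)
  import Data.Integer.Properties as ℤP
  open import Data.Product using (_,_; proj₁; proj₂)
  open import Relation.Binary.PropositionalEquality using (_≡_; refl; cong; cong₂; sym; trans)
  open IntegerCongruence
  open EisensteinIntegers
  open CommutativeSemiring (ℤ[ω]/ p) using (_≈_; 1#; 0#)
  open import Algebra.Properties.Monoid.Mult (CommutativeSemiring.+-monoid (ℤ[ω]/ p)) using (_×_)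
  open import Algebra.Properties.Semiring.Exp (CommutativeSemiring.semiring (ℤ[ω]/ p))
    using () renaming (_^_ to _^ω_)
  open FreshmansDream (ℤ[ω]/ p) using (fermat)

  ×-pair : ∀ n x → n × x ≡ (+ n * proj₁ x , + n * proj₂ x)
  ×-pair zero    x       = refl
  ×-pair (suc n) (a , b) = trans (cong ((a , b) ⊕_) (×-pair n (a , b)))
                                 (cong₂ _,_ (sym (ℤP.suc-* (+ n) a)) (sym (ℤP.suc-* (+ n) b)))

  p×x≈0 : ∀ x → p × x ≈ 0#
  p×x≈0 x rewrite ×-pair p x = m*x≡0-mod _ , m*x≡0-mod _

  n×1≡ι : ∀ n → n × 1# ≡ ι (+ n)
  n×1≡ι zero    = refl
  n×1≡ι (suc n) = cong (ι 1ℤ ⊕_) (n×1≡ι n)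

  ι-^ : ∀ a n → ι a ^ω n ≡ ι (a ^ n)
  ι-^ a zero    = refl
  ι-^ a (suc n) = trans (cong (ι a ⊗_) (ι-^ a n)) (ι-⊗ a (a ^ n))

  fermat-little : ∀ a → (+ a) ^ p ≡ + a mod p
  fermat-little a with fermat p-prime p×x≈0 a
  ... | aᵖ≈a rewrite n×1≡ι a | ι-^ (+ a) p = proj₁ aᵖ≈a

  fermat-little′ : ∀ {a} → p ∤ a → (+ a) ^ (p ∸ 1) ≡ 1ℤ mod p
  fermat-little′ {a} p∤a = *-cancelˡ-mod {a = + a} p-prime p∤a (begin
    + a * (+ a) ^ (p ∸ 1)  ≡⟨ cong ((+ a) ^_) (ℕP.suc-pred p {{prime⇒nonZero p-prime}}) ⟩
    (+ a) ^ p              ≈⟨ fermat-little a ⟩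
    + a                    ≡⟨ ℤP.*-identityʳ (+ a) ⟨
    + a * 1ℤ               ∎)
    where open ≡-mod-Reasoning p

module TwelveNonResidue {p : ℕ} (p-prime : Prime p) where

  open import Data.Nat as ℕ using (zero; suc; _∸_)
  open import Data.Nat.Divisibility using (_∤_; ∣⇒≤)
  open import Data.Nat.Primality using (¬prime[1])
  import Data.Nat.Properties as ℕP
  import Data.Nat.Tactic.RingSolver as ℕ-Solver
  open import Data.Empty using (⊥-elim)
  open import Data.Integer using (+_; _*_; -_; _^_; 1ℤ; -1ℤ)
  import Data.Integer.Properties as ℤP
  open import Data.Product using (_,_; proj₁)
  open import Relation.Binary.PropositionalEquality using (_≡_; refl; cong; sym; trans; subst)
  open IntegerCongruence
  open EisensteinIntegers
  open CommutativeSemiring (ℤ[ω]/ p)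
    using (_≈_; setoid; reflexive; +-cong; +-congˡ; *-cong; *-congˡ; *-identityʳ)
  open import Algebra.Properties.Semiring.Exp (CommutativeSemiring.semiring (ℤ[ω]/ p))
    renaming (_^_ to _^ω_)
  open import Algebra.Properties.CommutativeSemiring.Exp (ℤ[ω]/ p) using (^-distrib-*)
  open FreshmansDream (ℤ[ω]/ p) using (freshman's-dream; fermat)
  open FermatLittle p-prime using (p×x≈0; ι-^; fermat-little′)

  ι1^≡ι1 : ∀ n → ι 1ℤ ^ω n ≡ ι 1ℤ
  ι1^≡ι1 n = trans (ι-^ 1ℤ n) (cong ι (ℤP.^-zeroˡ n))

  private
    p≡4h+1⇒3<p : ∀ {h} → p ≡ 4 ℕ.* h ℕ.+ 1 → 3 ℕ.< p
    p≡4h+1⇒3<p {zero}  p≡1 = ⊥-elim (¬prime[1] (subst Prime p≡1 p-prime))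
    p≡4h+1⇒3<p {suc h} refl = ℕP.≤-trans (ℕP.m≤m*n 4 (suc h)) (ℕP.m≤m+n _ 1)

  module _ {h j} (p≡4h+1 : p ≡ 4 ℕ.* h ℕ.+ 1) (p≡3j+2 : p ≡ 3 ℕ.* j ℕ.+ 2) where

    ω^p≈ω² : ω ^ω p ≈ ω ^ω 2
    ω^p≈ω² = begin
      ω ^ω p                       ≡⟨ cong (ω ^ω_) (trans p≡3j+2 (ℕP.+-comm (3 ℕ.* j) 2)) ⟩
      ω ^ω (2 ℕ.+ 3 ℕ.* j)         ≈⟨ ^-homo-* ω 2 (3 ℕ.* j) ⟩
      ω ^ω 2 ⊗ ω ^ω (3 ℕ.* j)      ≈⟨ *-congˡ {ω ^ω 2} (^-assocʳ ω 3 j) ⟨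
      ω ^ω 2 ⊗ (ω ^ω 3) ^ω j       ≡⟨ cong (ω ^ω 2 ⊗_) (ι1^≡ι1 j) ⟩
      ω ^ω 2 ⊗ ι 1ℤ                ≈⟨ *-identityʳ _ ⟩
      ω ^ω 2                       ∎
      where open import Relation.Binary.Reasoning.Setoid setoid

    -- τ = 1 + 2ω squares to −3, and as p ≡ 2 (mod 3) the Frobenius sends it to 1 + 2ω² = −τ;
    -- hence (−3)^((p+1)/2) = τ^(p+1) = −τ² = 3.
    τ : ℤ[ω]
    τ = ι 1ℤ ⊕ ι (+ 2) ⊗ ω

    τ^p≈-τ : τ ^ω p ≈ (-1ℤ , - + 2)
    τ^p≈-τ = begin
      (ι 1ℤ ⊕ ι (+ 2) ⊗ ω) ^ω p
        ≈⟨ freshman's-dream p-prime p×x≈0 (ι 1ℤ) (ι (+ 2) ⊗ ω) ⟩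
      ι 1ℤ ^ω p ⊕ (ι (+ 2) ⊗ ω) ^ω p
        ≈⟨ +-cong (reflexive (ι1^≡ι1 p)) (^-distrib-* (ι (+ 2)) ω p) ⟩
      ι 1ℤ ⊕ ι (+ 2) ^ω p ⊗ ω ^ω p
        ≈⟨ +-congˡ {ι 1ℤ} (*-cong (fermat p-prime p×x≈0 2) ω^p≈ω²) ⟩
      ι 1ℤ ⊕ ι (+ 2) ⊗ ω ^ω 2
        ∎
      where open import Relation.Binary.Reasoning.Setoid setoid

    [-3]^[2h+1]≡3 : (- + 3) ^ (2 ℕ.* h ℕ.+ 1) ≡ + 3 mod p
    [-3]^[2h+1]≡3 = proj₁ (begin
      ι ((- + 3) ^ (2 ℕ.* h ℕ.+ 1))  ≡⟨ ι-^ (- + 3) (2 ℕ.* h ℕ.+ 1) ⟨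
      (τ ^ω 2) ^ω (2 ℕ.* h ℕ.+ 1)    ≈⟨ ^-assocʳ τ 2 (2 ℕ.* h ℕ.+ 1) ⟩
      τ ^ω (2 ℕ.* (2 ℕ.* h ℕ.+ 1))   ≡⟨ cong (τ ^ω_) (trans (lemma h) (cong suc (sym p≡4h+1))) ⟩
      τ ⊗ τ ^ω p                     ≈⟨ *-congˡ {τ} τ^p≈-τ ⟩
      ι (+ 3)                        ∎)
      where
      open import Relation.Binary.Reasoning.Setoid setoid
      lemma : ∀ h → 2 ℕ.* (2 ℕ.* h ℕ.+ 1) ≡ suc (4 ℕ.* h ℕ.+ 1)
      lemma = ℕ-Solver.solve-∀

    private
      p∤n≤3 : ∀ n .{{_ : ℕ.NonZero n}} → n ℕ.≤ 3 → p ∤ n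
      p∤n≤3 n n≤3 p∣n = ℕP.≤⇒≯ (ℕP.≤-trans (∣⇒≤ p∣n) n≤3) (p≡4h+1⇒3<p {h} p≡4h+1)

    9^h≡-1 : (+ 9) ^ h ≡ -1ℤ mod p
    9^h≡-1 = *-cancelˡ-mod {a = - + 3} p-prime (p∤n≤3 3 ℕP.≤-refl) (begin
      (- + 3) * (+ 9) ^ h           ≡⟨ cong ((- + 3) *_) (ℤP.^-*-assoc (- + 3) 2 h) ⟩
      (- + 3) ^ suc (2 ℕ.* h)       ≡⟨ cong ((- + 3) ^_) (ℕP.+-comm 1 (2 ℕ.* h)) ⟩
      (- + 3) ^ (2 ℕ.* h ℕ.+ 1)     ≈⟨ [-3]^[2h+1]≡3 ⟩
      (- + 3) * -1ℤ                 ∎)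
      where open ≡-mod-Reasoning p

    16^h≡1 : (+ 16) ^ h ≡ 1ℤ mod p
    16^h≡1 = begin
      (+ 16) ^ h           ≡⟨ ℤP.^-*-assoc (+ 2) 4 h ⟩
      (+ 2) ^ (4 ℕ.* h)    ≡⟨ cong (λ n → (+ 2) ^ (n ∸ 1)) 1+4h≡p ⟩
      (+ 2) ^ (p ∸ 1)      ≈⟨ fermat-little′ (p∤n≤3 2 (ℕP.n≤1+n 2)) ⟩
      1ℤ                   ∎
      where
      open ≡-mod-Reasoning p
      1+4h≡p : suc (4 ℕ.* h) ≡ p
      1+4h≡p = trans (ℕP.+-comm 1 (4 ℕ.* h)) (sym p≡4h+1)

    12^[2h]≡-1 : (+ 12) ^ (2 ℕ.* h) ≡ -1ℤ mod p
    12^[2h]≡-1 = begin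
      (+ 12) ^ (2 ℕ.* h)       ≡⟨ ℤP.^-*-assoc (+ 12) 2 h ⟨
      (+ 144) ^ h              ≡⟨ ^-distribʳ-* (+ 9) (+ 16) h ⟩
      (+ 9) ^ h * (+ 16) ^ h   ≈⟨ *-cong-mod 9^h≡-1 16^h≡1 ⟩
      -1ℤ * 1ℤ                 ∎
      where open ≡-mod-Reasoning p

module PowerDivisibility where

  open import Data.Nat using (zero; suc; _+_; _*_; _^_; _∸_; _≤_; _<_; z≤n; s≤s)
  open import Data.Nat.Properties
    using ( *-comm; *-assoc; +-identityʳ; m≤n⇒m≤1+n; m+[n∸m]≡n; ^-distribˡ-+-*
          ; ≤-trans; m<m+n; m^n>0; m≤m+n)
  import Data.Nat.Tactic.RingSolver as ℕ-Solver
  open import Data.Nat.Divisibility using (_∣_; _∤_; divides; _∣?_; ∣1⇒≡1; *-cancelʳ-∣)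
  open import Data.Nat.Coprimality using (Coprime; coprime-divisor)
  open import Data.Nat.Primality using (prime⇒irreducible; prime⇒nonZero)
  open import Data.Product using (∃-syntax; _×_; _,_)
  open import Data.Sum using (inj₁; inj₂)
  open import Relation.Binary.PropositionalEquality
    using (_≡_; refl; cong; trans; subst; module ≡-Reasoning)
  open import Relation.Nullary using (yes; no; contradiction)

  ∤⇒coprime : ∀ {p n} → Prime p → p ∤ n → Coprime n p
  ∤⇒coprime p-prime p∤n (d∣n , d∣p) with prime⇒irreducible p-prime d∣p
  ... | inj₁ d≡1    = d≡1
  ... | inj₂ refl   = contradiction d∣n p∤n

  ∣p^n⇒≡p^i : ∀ {p d} n → Prime p → d ∣ p ^ n → ∃[ i ] i ≤ n × d ≡ p ^ i
  ∣p^n⇒≡p^i zero    p-prime d∣1 = 0 , z≤n , ∣1⇒≡1 d∣1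
  ∣p^n⇒≡p^i {p} {d} (suc n) p-prime d∣p^[1+n] with p ∣? d
  ... | yes (divides e refl) with ∣p^n⇒≡p^i {d = e} n p-prime e∣pⁿ
    where
    e∣pⁿ : e ∣ p ^ n
    e∣pⁿ = *-cancelʳ-∣ p {{prime⇒nonZero p-prime}} (subst (e * p ∣_) (*-comm p (p ^ n)) d∣p^[1+n])
  ...   | i , i≤n , e≡pⁱ = suc i , s≤s i≤n , trans (cong (_* p) e≡pⁱ) (*-comm (p ^ i) p)
  ∣p^n⇒≡p^i {p} {d} (suc n) p-prime d∣p^[1+n] | no p∤d
    with ∣p^n⇒≡p^i n p-prime (coprime-divisor (∤⇒coprime p-prime p∤d) d∣p^[1+n])
  ... | i , i≤n , d≡pⁱ = i , m≤n⇒m≤1+n i≤n , d≡pⁱ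

  coprime-divisor-^ : ∀ {d c} → Coprime d c → ∀ k {x} → d ∣ c ^ k * x → d ∣ x
  coprime-divisor-^ d⊥c zero    {x} d∣x = subst (_ ∣_) (+-identityʳ x) d∣x
  coprime-divisor-^ {d} {c} d⊥c (suc k) {x} d∣cᵏ⁺¹x =
    coprime-divisor-^ d⊥c k (coprime-divisor d⊥c (subst (d ∣_) (*-assoc c (c ^ k) x) d∣cᵏ⁺¹x))

  ^-distribʳ-* : ∀ a b n → (a * b) ^ n ≡ a ^ n * b ^ n
  ^-distribʳ-* a b zero    = refl
  ^-distribʳ-* a b (suc n) =
    trans (cong ((a * b) *_) (^-distribʳ-* a b n)) (lemma a b (a ^ n) (b ^ n))
    where
    lemma : ∀ a b x y → (a * b) * (x * y) ≡ (a * x) * (b * y)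
    lemma = ℕ-Solver.solve-∀

  ^-monoʳ-∣ : ∀ m {i j} → i ≤ j → m ^ i ∣ m ^ j
  ^-monoʳ-∣ m {i} {j} i≤j = divides (m ^ (j ∸ i)) (begin
    m ^ j                ≡⟨ cong (m ^_) (m+[n∸m]≡n i≤j) ⟨
    m ^ (i + (j ∸ i))    ≡⟨ ^-distribˡ-+-* m i (j ∸ i) ⟩
    m ^ i * m ^ (j ∸ i)  ≡⟨ *-comm (m ^ i) (m ^ (j ∸ i)) ⟩
    m ^ (j ∸ i) * m ^ i  ∎)
    where open ≡-Reasoning

  n<2^n : ∀ n → n < 2 ^ n
  n<2^n zero    = s≤s z≤n
  n<2^n (suc n) = ≤-trans (s≤s (n<2^n n)) (m<m+n (2 ^ n) (≤-trans (m^n>0 2 n) (m≤m+n (2 ^ n) 0)))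

module Roughness where

  open import Data.Nat using (_≤_; _<_; n>1⇒nonTrivial; nonTrivial⇒n>1)
  open import Data.Nat.Properties using (≤-trans; <⇒≤; <⇒≱)
  open import Data.Nat.Divisibility using (_∣_; ∣-trans)
  open import Data.Nat.Divisibility.Core using (hasNonTrivialDivisor)
  open import Data.Nat.Primality using (_Rough_; prime?; ¬prime⇒composite)
  open import Data.Nat.Induction using (<-rec)
  open import Relation.Nullary using (yes; no)

  prime-divisors≥⇒rough : ∀ {m n} → (∀ {q} → Prime q → q ∣ n → m ≤ q) → m Rough n
  prime-divisors≥⇒rough {m} {n} bound (hasNonTrivialDivisor {d} d<m d∣n) =
    <⇒≱ d<m (<-rec Bounded bounded d (nonTrivial⇒n>1 d) d∣n)
    where
    Bounded : ℕ → Set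
    Bounded d = 1 < d → d ∣ n → m ≤ d
    bounded : ∀ d → (∀ {d′} → d′ < d → Bounded d′) → Bounded d
    bounded d rec 1<d d∣n with prime? d
    ... | yes d-prime = bound d-prime d∣n
    ... | no ¬d-prime with ¬prime⇒composite {{n>1⇒nonTrivial 1<d}} ¬d-prime
    ...   | hasNonTrivialDivisor {d′} d′<d d′∣d =
            ≤-trans (rec d′<d (nonTrivial⇒n>1 d′) (∣-trans d′∣d d∣n)) (<⇒≤ d′<d)

module GeneralisedFermatNumbers where

  open import Data.Nat using (suc; _+_; _*_; _^_; _∸_; _≤_; _<_; s≤s; n>1⇒nonTrivial)
  import Data.Nat.Properties as ℕP
  open import Data.Nat.Divisibility using (_∣_; _∤_; ∣-trans; ∣1⇒≡1; ∣m+n∣m⇒∣n; m∣m*n; ∣⇒≤)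
  open import Data.Nat.GCD using (gcd[m,n]∣m; gcd[m,n]∣n)
  open import Data.Integer as ℤ using (+_; -1ℤ; 1ℤ) renaming (_^_ to _^ℤ_)
  import Data.Integer.Properties as ℤP
  open import Data.Integer.Divisibility.Signed using (∣⇒∣ᵤ)
  open import Data.Product using (_,_)
  open import Data.Sum using (inj₁; inj₂)
  open import Data.Nat.Primality using (prime[2]; ¬prime[1]; rough∧∣⇒prime)
  open import Relation.Binary.PropositionalEquality using (_≡_; refl; cong; subst)
  open import Relation.Nullary using (contradiction)
  open IntegerCongruence
  open PowerDivisibility using (∣p^n⇒≡p^i)
  open Roughness using (prime-divisors≥⇒rough)

  -- The order of a modulo q divides 2^(t+1) but not 2ᵗ, and it divides q − 1.
  2^[1+t]∣q-1 : ∀ {q a} t → Prime q → q ∤ 2 → q ∤ a → (+ a) ^ℤ (2 ^ t) ≡ -1ℤ mod q →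
                2 ^ suc t ∣ q ∸ 1
  2^[1+t]∣q-1 {q} {a} t q-prime q∤2 q∤a x^2ᵗ≡-1
    with ∣p^n⇒≡p^i (suc t) prime[2] (gcd[m,n]∣m (2 ^ suc t) (q ∸ 1))
  ... | i , i≤1+t , G≡2ⁱ with ℕP.m≤n⇒m<n∨m≡n i≤1+t
  ...   | inj₂ refl = subst (_∣ q ∸ 1) G≡2ⁱ (gcd[m,n]∣n (2 ^ suc t) (q ∸ 1))
  ...   | inj₁ (s≤s i≤t) = contradiction (∣⇒∣ᵤ (divides-difference 1≡-1)) q∤2
    where
    open FermatLittle q-prime using (fermat-little′)
    open ≡-mod-Reasoning q
    x = + a
    x^2ᵗ⁺¹≡1 : x ^ℤ (2 ^ suc t) ≡ 1ℤ mod q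
    x^2ᵗ⁺¹≡1 = begin
      x ^ℤ (2 ^ suc t)    ≡⟨ cong (x ^ℤ_) (ℕP.*-comm 2 (2 ^ t)) ⟩
      x ^ℤ (2 ^ t * 2)    ≡⟨ ℤP.^-*-assoc x (2 ^ t) 2 ⟨
      (x ^ℤ (2 ^ t)) ^ℤ 2 ≈⟨ ^-cong-mod 2 x^2ᵗ≡-1 ⟩
      1ℤ                  ∎
    x^2ⁱ≡1 : x ^ℤ (2 ^ i) ≡ 1ℤ mod q
    x^2ⁱ≡1 = subst (λ n → x ^ℤ n ≡ 1ℤ mod q) G≡2ⁱ
               (^≡1-gcd {x = x} {2 ^ suc t} {q ∸ 1} x^2ᵗ⁺¹≡1 (fermat-little′ q∤a))
    1≡-1 : 1ℤ ≡ -1ℤ mod q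
    1≡-1 = begin
      1ℤ                        ≈⟨ ^≡1⇒^*≡1 {x = x} {2 ^ i} x^2ⁱ≡1 (2 ^ (t ∸ i)) ⟨
      x ^ℤ (2 ^ i * 2 ^ (t ∸ i)) ≡⟨ cong (x ^ℤ_) (ℕP.^-distribˡ-+-* 2 i (t ∸ i)) ⟨
      x ^ℤ (2 ^ (i + (t ∸ i)))   ≡⟨ cong (λ n → x ^ℤ (2 ^ n)) (ℕP.m+[n∸m]≡n i≤t) ⟩
      x ^ℤ (2 ^ t)              ≈⟨ x^2ᵗ≡-1 ⟩
      -1ℤ                       ∎

  prime∣a^2^t+1⇒2^[1+t]∣q-1 : ∀ {a q} t → 2 ∣ a → Prime q → q ∣ a ^ 2 ^ t + 1 → 2 ^ suc t ∣ q ∸ 1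
  prime∣a^2^t+1⇒2^[1+t]∣q-1 {a} {q} t 2∣a q-prime q∣aᴱ+1 =
    2^[1+t]∣q-1 t q-prime (λ q∣2 → q∤a (∣-trans q∣2 2∣a)) q∤a
      (subst (_≡ -1ℤ mod q) (pos-^ a (2 ^ t)) (∣+1⇒≡-1-mod q∣aᴱ+1))
    where
    a∣aᴱ : a ∣ a ^ 2 ^ t
    a∣aᴱ = subst (λ n → a ∣ a ^ n) (ℕP.suc-pred (2 ^ t) {{ℕP.m^n≢0 2 t}}) (m∣m*n _)
    q∤a : q ∤ a
    q∤a q∣a = ¬prime[1] (subst Prime (∣1⇒≡1 (∣m+n∣m⇒∣n q∣aᴱ+1 (∣-trans q∣a a∣aᴱ))) q-prime)

  2^[1+t]+1∣a^2^t+1⇒prime : ∀ {a} t → 2 ∣ a → 2 ^ suc t + 1 ∣ a ^ 2 ^ t + 1 → Prime (2 ^ suc t + 1)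
  2^[1+t]+1∣a^2^t+1⇒prime {a} t 2∣a N∣aᴱ+1 =
    rough∧∣⇒prime {{n>1⇒nonTrivial 1<N}} (prime-divisors≥⇒rough N≤prime-divisor) N∣aᴱ+1
    where
    1<N : 1 < 2 ^ suc t + 1
    1<N = ℕP.+-monoˡ-< 1 (ℕP.m^n>0 2 (suc t))
    N≤prime-divisor : ∀ {q} → Prime q → q ∣ a ^ 2 ^ t + 1 → 2 ^ suc t + 1 ≤ q
    N≤prime-divisor {suc (suc k)} q-prime q∣aᴱ+1 =
      subst (2 ^ suc t + 1 ≤_) (ℕP.+-comm (suc k) 1)
            (ℕP.+-monoˡ-≤ 1 (∣⇒≤ (prime∣a^2^t+1⇒2^[1+t]∣q-1 t 2∣a q-prime q∣aᴱ+1)))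

module FermatPrimeExponents where

  open import Data.Nat using (zero; suc; _+_; _*_; _^_; _<_; s≤s; z≤n)
  import Data.Nat.Properties as ℕP
  open import Data.Nat.Divisibility using (_∣_)
  open import Data.Nat.Induction using (<-rec)
  open import Data.Nat.Primality using (prime⇒irreducible)
  open import Data.Integer as ℤ using (+_; -1ℤ; 1ℤ) renaming (_^_ to _^ℤ_; _*_ to _*ℤ_)
  import Data.Integer.Properties as ℤP
  open import Data.Integer.Divisibility.Signed using (divides)
  open import Data.Product using (∃-syntax; _,_; map)
  open import Data.Sum using (_⊎_; inj₁; inj₂; [_,_])
  open import Relation.Binary.PropositionalEquality using (_≡_; _≢_; refl; cong; sym; trans; subst)
  open import Relation.Nullary using (¬_; contradiction)
  import Data.Nat.Tactic.RingSolver as ℕ-Solver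
  open IntegerCongruence

  even-or-odd : ∀ n → ∃[ h ] (n ≡ 2 * h ⊎ n ≡ suc (2 * h))
  even-or-odd zero = 0 , inj₁ refl
  even-or-odd (suc n) with even-or-odd n
  ... | h , inj₁ n≡2h   = h , inj₂ (cong suc n≡2h)
  ... | h , inj₂ n≡1+2h = suc h , inj₁ (trans (cong suc n≡1+2h) (lemma h))
    where
    lemma : ∀ h → suc (suc (2 * h)) ≡ 2 * suc h
    lemma = ℕ-Solver.solve-∀

  1+y∣y^[1+2h]+1 : ∀ y h → suc y ∣ y ^ suc (2 * h) + 1
  1+y∣y^[1+2h]+1 y h = ≡-1-mod⇒∣+1 (begin
    + (y ^ suc (2 * h))       ≡⟨ pos-^ y (suc (2 * h)) ⟩
    (+ y) ^ℤ suc (2 * h)      ≈⟨ ^-cong-mod (suc (2 * h)) y≡-1 ⟩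
    -1ℤ ^ℤ suc (2 * h)        ≡⟨ cong (-1ℤ *ℤ_) (ℤP.^-*-assoc -1ℤ 2 h) ⟨
    -1ℤ *ℤ 1ℤ ^ℤ h            ≡⟨ cong (-1ℤ *ℤ_) (ℤP.^-zeroˡ h) ⟩
    -1ℤ                       ∎)
    where
    open ≡-mod-Reasoning (suc y)
    y≡-1 : + y ≡ -1ℤ mod suc y
    y≡-1 = congruent (divides 1ℤ (trans (ℤP.+-comm (+ y) 1ℤ) (sym (ℤP.*-identityˡ (+ suc y)))))

  ¬prime-y^[3+2h]+1 : ∀ {y} h → 1 < y → ¬ Prime (y ^ suc (2 * suc h) + 1)
  ¬prime-y^[3+2h]+1 {y} h 1<y yˢ+1-prime =
    [ 1+y≢1 , 1+y≢yˢ+1 ] (prime⇒irreducible yˢ+1-prime (1+y∣y^[1+2h]+1 y (suc h)))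
    where
    s = suc (2 * suc h)
    1+y≢1 : suc y ≢ 1
    1+y≢1 1+y≡1 = ℕP.<⇒≢ (ℕP.<-trans (s≤s z≤n) 1<y) (sym (ℕP.suc-injective 1+y≡1))
    1+y≢yˢ+1 : suc y ≢ y ^ s + 1
    1+y≢yˢ+1 1+y≡yˢ+1 = ℕP.<⇒≢ y<yˢ (ℕP.suc-injective (trans 1+y≡yˢ+1 (ℕP.+-comm (y ^ s) 1)))
      where
      y<yˢ : y < y ^ s
      y<yˢ = subst (_< y ^ s) (ℕP.*-identityʳ y) (ℕP.^-monoʳ-< y 1<y {1} {s} (s≤s (s≤s z≤n)))

  prime-y^s+1⇒s≡2^k : ∀ s {y} → 1 < y → 0 < s → Prime (y ^ s + 1) → ∃[ k ] s ≡ 2 ^ k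
  prime-y^s+1⇒s≡2^k = <-rec P step
    where
    P : ℕ → Set
    P s = ∀ {y} → 1 < y → 0 < s → Prime (y ^ s + 1) → ∃[ k ] s ≡ 2 ^ k
    step : ∀ s → (∀ {s′} → s′ < s → P s′) → P s
    step s rec {y} 1<y 0<s yˢ+1-prime with even-or-odd s
    ... | zero  , inj₁ refl = contradiction 0<s (λ ())
    ... | suc h , inj₁ refl =
      map suc (cong (2 *_)) (rec h<2h (ℕP.^-monoˡ-< 2 1<y) (s≤s z≤n) y²ʰ+1-prime)
      where
      h<2h : suc h < 2 * suc h
      h<2h = ℕP.m<m+n (suc h) (s≤s z≤n)
      y²ʰ+1-prime : Prime ((y ^ 2) ^ suc h + 1)
      y²ʰ+1-prime = subst (λ n → Prime (n + 1)) (sym (ℕP.^-*-assoc y 2 (suc h))) yˢ+1-prime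
    ... | zero  , inj₂ refl = 0 , refl
    ... | suc h , inj₂ refl = contradiction yˢ+1-prime (¬prime-y^[3+2h]+1 h 1<y)

module FermatPrimeCriterion where

  open import Data.Nat using (zero; suc; _+_; _*_; _^_; _≤_; s≤s; z≤n; pred)
  import Data.Nat.Properties as ℕP
  open import Data.Nat.Divisibility using (_∣_; _∤_; divides; ∣⇒≤; ∣m+n∣m⇒∣n; m∣m*n; ∣n⇒∣m*n)
  open import Data.Nat.Primality using (prime[2]; prime?)
  open import Data.Integer using (+_; -1ℤ) renaming (_^_ to _^ℤ_)
  open import Data.Product using (∃-syntax; _×_; _,_; map₂)
  open import Relation.Binary.PropositionalEquality
    using (_≡_; refl; cong; sym; trans; subst; subst₂; module ≡-Reasoning)
  open import Relation.Nullary using (contradiction)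
  open import Relation.Nullary.Decidable using (from-yes)
  import Data.Nat.Tactic.RingSolver as ℕ-Solver
  open import Defs using (FermatPrime)
  open IntegerCongruence using (_≡_mod_; pos-^; ≡-1-mod⇒∣+1)
  open PowerDivisibility
    using (∤⇒coprime; ∣p^n⇒≡p^i; coprime-divisor-^; ^-distribʳ-*; ^-monoʳ-∣; n<2^n)
  open TwelveNonResidue using (12^[2h]≡-1)
  open GeneralisedFermatNumbers using (2^[1+t]+1∣a^2^t+1⇒prime)
  open FermatPrimeExponents using (prime-y^s+1⇒s≡2^k)

  private
    6g+5≡2[3g+2]+1 : ∀ g → 6 * g + 5 ≡ 2 * (3 * g + 2) + 1
    6g+5≡2[3g+2]+1 = ℕ-Solver.solve-∀

    12^n≡3^n*2^[2n] : ∀ n → 12 ^ n ≡ 3 ^ n * 2 ^ (2 * n)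
    12^n≡3^n*2^[2n] n = trans (^-distribʳ-* 3 4 n) (cong (3 ^ n *_) (ℕP.^-*-assoc 2 2 n))

  2^a∣12^2^a : ∀ a → 2 ^ a ∣ 12 ^ 2 ^ a
  2^a∣12^2^a a =
    subst (2 ^ a ∣_) (sym (12^n≡3^n*2^[2n] (2 ^ a))) (∣n⇒∣m*n (3 ^ 2 ^ a) (^-monoʳ-∣ 2 a≤2·2ᵃ))
    where
    a≤2·2ᵃ : a ≤ 2 * 2 ^ a
    a≤2·2ᵃ = ℕP.≤-trans (ℕP.<⇒≤ (n<2^n a)) (ℕP.m≤m+n (2 ^ a) _)

  3∤d∣12^n⇒d≡2^t : ∀ {d} n → 3 ∤ d → d ∣ 12 ^ n → ∃[ t ] d ≡ 2 ^ t
  3∤d∣12^n⇒d≡2^t {d} n 3∤d d∣12ⁿ with ∣p^n⇒≡p^i (2 * n) prime[2] d∣2^[2n]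
    where
    d∣2^[2n] : d ∣ 2 ^ (2 * n)
    d∣2^[2n] = coprime-divisor-^ (∤⇒coprime (from-yes (prime? 3)) 3∤d) n
                 (subst (d ∣_) (12^n≡3^n*2^[2n] n) d∣12ⁿ)
  ... | t , _ , d≡2ᵗ = t , d≡2ᵗ

  fermatPrime⇒divisibilities : ∀ g → FermatPrime (6 * g + 5) →
                               3 * g + 2 ∣ 12 ^ (3 * g + 2) × 6 * g + 5 ∣ 12 ^ (3 * g + 2) + 1
  fermatPrime⇒divisibilities g (_ , zero , 6g+5≡3) =
    contradiction (subst (5 ≤_) 6g+5≡3 (ℕP.m≤n+m 5 (6 * g))) λ { (s≤s (s≤s (s≤s ()))) }
  fermatPrime⇒divisibilities g (p-prime , suc k , 6g+5≡F) =
    subst (λ e → e ∣ 12 ^ e) (sym e≡2X) (2^a∣12^2^a (suc (2 * m))) , p∣12ᵉ+1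
    where
    e = 3 * g + 2
    m = pred (2 ^ k)
    X = 2 ^ (2 * m)
    e≡2X : e ≡ 2 * X
    e≡2X = ℕP.*-cancelˡ-≡ e (2 * X) 2 (ℕP.+-cancelʳ-≡ _ _ _ (begin
      2 * e + 1              ≡⟨ 6g+5≡2[3g+2]+1 g ⟨
      6 * g + 5              ≡⟨ 6g+5≡F ⟩
      2 ^ (2 * 2 ^ k) + 1    ≡⟨ cong (λ n → 2 ^ (2 * n) + 1) (ℕP.suc-pred _ {{ℕP.m^n≢0 2 k}}) ⟨
      2 ^ (2 * suc m) + 1    ≡⟨ cong (λ n → 2 ^ n + 1) (lemma m) ⟩
      2 * (2 * X) + 1        ∎))
      where
      open ≡-Reasoning
      lemma : ∀ m → 2 * suc m ≡ suc (suc (2 * m))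
      lemma = ℕ-Solver.solve-∀

    p≡4X+1 : 6 * g + 5 ≡ 4 * X + 1
    p≡4X+1 = trans (6g+5≡2[3g+2]+1 g) (trans (cong (λ n → 2 * n + 1) e≡2X) (lemma X))
      where
      lemma : ∀ X → 2 * (2 * X) + 1 ≡ 4 * X + 1
      lemma = ℕ-Solver.solve-∀

    p≡3[2g+1]+2 : 6 * g + 5 ≡ 3 * (2 * g + 1) + 2
    p≡3[2g+1]+2 = lemma g
      where
      lemma : ∀ g → 6 * g + 5 ≡ 3 * (2 * g + 1) + 2
      lemma = ℕ-Solver.solve-∀

    p∣12ᵉ+1 : 6 * g + 5 ∣ 12 ^ e + 1
    p∣12ᵉ+1 = ≡-1-mod⇒∣+1 (subst (_≡ -1ℤ mod (6 * g + 5))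
                (trans (cong ((+ 12) ^ℤ_) (sym e≡2X)) (sym (pos-^ 12 e)))
                (12^[2h]≡-1 p-prime {X} {2 * g + 1} p≡4X+1 p≡3[2g+1]+2))

  divisibilities⇒fermatPrime : ∀ g → 3 * g + 2 ∣ 12 ^ (3 * g + 2) →
                               6 * g + 5 ∣ 12 ^ (3 * g + 2) + 1 → FermatPrime (6 * g + 5)
  divisibilities⇒fermatPrime g e∣12ᵉ p∣12ᵉ+1 with 3∤d∣12^n⇒d≡2^t (3 * g + 2) 3∤3g+2 e∣12ᵉ
    where
    3∤3g+2 : 3 ∤ 3 * g + 2
    3∤3g+2 3∣e = contradiction (∣⇒≤ (∣m+n∣m⇒∣n 3∣e (m∣m*n g))) λ { (s≤s (s≤s ())) }
  ... | t , e≡2ᵗ =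
    subst Prime (sym p≡2^[1+t]+1) p-prime ,
    map₂ (λ 1+t≡2ᵏ → trans p≡2^[1+t]+1 (cong (λ n → 2 ^ n + 1) 1+t≡2ᵏ))
         (prime-y^s+1⇒s≡2^k (suc t) (s≤s (s≤s z≤n)) (s≤s z≤n) p-prime)
    where
    p≡2^[1+t]+1 : 6 * g + 5 ≡ 2 ^ suc t + 1
    p≡2^[1+t]+1 = trans (6g+5≡2[3g+2]+1 g) (cong (λ n → 2 * n + 1) e≡2ᵗ)
    p-prime : Prime (2 ^ suc t + 1)
    p-prime = 2^[1+t]+1∣a^2^t+1⇒prime t (divides 6 refl)
                (subst₂ (λ p n → p ∣ 12 ^ n + 1) p≡2^[1+t]+1 e≡2ᵗ p∣12ᵉ+1)

module SumOfSquares where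

  import Data.Nat as ℕ
  import Data.Nat.Properties as ℕP
  open import Data.Integer using (+_; -[1+_]; _+_; _*_; 0ℤ; ∣_∣)
  import Data.Integer.Properties as ℤP
  open import Data.Product using (_×_; _,_)
  open import Data.Sum using (inj₁; inj₂)
  open import Relation.Binary.PropositionalEquality
    using (_≡_; refl; sym; cong₂; module ≡-Reasoning)

  i*i≡+∣i∣*∣i∣ : ∀ i → i * i ≡ + (∣ i ∣ ℕ.* ∣ i ∣)
  i*i≡+∣i∣*∣i∣ (+ n)    = sym (ℤP.pos-* n n)
  i*i≡+∣i∣*∣i∣ -[1+ n ] = refl

  i*i≡0⇒i≡0 : ∀ {i} → ∣ i ∣ ℕ.* ∣ i ∣ ≡ 0 → i ≡ 0ℤ
  i*i≡0⇒i≡0 {i} eq with ℕP.m*n≡0⇒m≡0∨n≡0 ∣ i ∣ eq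
  ... | inj₁ ∣i∣≡0 = ℤP.∣i∣≡0⇒i≡0 ∣i∣≡0
  ... | inj₂ ∣i∣≡0 = ℤP.∣i∣≡0⇒i≡0 ∣i∣≡0

  x²+y²+z²≡0⇒ : ∀ x y z → x * x + y * y + z * z ≡ 0ℤ → x ≡ 0ℤ × y ≡ 0ℤ × z ≡ 0ℤ
  x²+y²+z²≡0⇒ x y z sum≡0 =
    i*i≡0⇒i≡0 (ℕP.m+n≡0⇒m≡0 X (ℕP.m+n≡0⇒m≡0 (X ℕ.+ Y) X+Y+Z≡0)) ,
    i*i≡0⇒i≡0 (ℕP.m+n≡0⇒n≡0 X (ℕP.m+n≡0⇒m≡0 (X ℕ.+ Y) X+Y+Z≡0)) ,
    i*i≡0⇒i≡0 (ℕP.m+n≡0⇒n≡0 (X ℕ.+ Y) X+Y+Z≡0)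
    where
    X = ∣ x ∣ ℕ.* ∣ x ∣
    Y = ∣ y ∣ ℕ.* ∣ y ∣
    Z = ∣ z ∣ ℕ.* ∣ z ∣
    X+Y+Z≡0 : X ℕ.+ Y ℕ.+ Z ≡ 0
    X+Y+Z≡0 = ℤP.+-injective (begin
      + (X ℕ.+ Y ℕ.+ Z)        ≡⟨ cong₂ _+_ (cong₂ _+_ (sq x) (sq y)) (sq z) ⟨
      x * x + y * y + z * z    ≡⟨ sum≡0 ⟩
      + 0                      ∎)
      where
      open ≡-Reasoning
      sq = i*i≡+∣i∣*∣i∣

module QuadraticForm where

  open import Data.Nat using (_+_; _*_; _^_)
  open import Data.Integer as ℤ using (+_; 0ℤ)
  import Data.Integer.Properties as ℤP
  open import Data.Integer.Tactic.RingSolver using (solve-∀)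
  open import Data.Product using (_×_; _,_)
  open import Relation.Binary.PropositionalEquality using (_≡_; refl; sym; trans)
  open import Defs using (Q)
  open SumOfSquares using (x²+y²+z²≡0⇒)

  private
    +m-+n≡0⇒n≡m : ∀ {m n} → + m ℤ.- + n ≡ 0ℤ → n ≡ m
    +m-+n≡0⇒n≡m {m} {n} eq = sym (ℤP.+-injective (ℤP.i-j≡0⇒i≡j (+ m) (+ n) eq))

    x-y-z≡x-[y+z] : ∀ x y z → x ℤ.- y ℤ.- z ≡ x ℤ.- (y ℤ.+ z)
    x-y-z≡x-[y+z] = solve-∀

    x+y-x-y≡0 : ∀ x y → x ℤ.+ y ℤ.- x ℤ.- y ≡ 0ℤ
    x+y-x-y≡0 = solve-∀

  Q≡0⇒ : ∀ {n g v a b} → Q n g v a b ≡ + 0 →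
         g + v ≡ n × 12 ^ (3 * g + 2) ≡ a * (3 * g + 2) × 12 ^ (3 * g + 2) + 1 ≡ b * (6 * g + 5)
  Q≡0⇒ {n} {g} {v} Q≡0 with x²+y²+z²≡0⇒ _ _ _ Q≡0
  ... | x≡0 , y≡0 , z≡0 =
    +m-+n≡0⇒n≡m (trans (sym (x-y-z≡x-[y+z] (+ n) (+ g) (+ v))) x≡0) ,
    sym (+m-+n≡0⇒n≡m y≡0) ,
    sym (+m-+n≡0⇒n≡m z≡0)

  ⇒Q≡0 : ∀ {n g v a b} →
         g + v ≡ n → 12 ^ (3 * g + 2) ≡ a * (3 * g + 2) → 12 ^ (3 * g + 2) + 1 ≡ b * (6 * g + 5) →
         Q n g v a b ≡ + 0
  ⇒Q≡0 {g = g} {v} refl 12ᵉ≡ae 12ᵉ+1≡bp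
    rewrite sym 12ᵉ≡ae | sym 12ᵉ+1≡bp
          | ℤP.+-inverseʳ (+ (12 ^ (3 * g + 2))) | ℤP.+-inverseʳ (+ (12 ^ (3 * g + 2) + 1))
          | ℤP.pos-+ g v | x+y-x-y≡0 (+ g) (+ v) = refl

module FilterCounting where

  open import Data.Nat using (zero; suc; _+_; _<_; _≮_; _<?_)
  import Data.Nat.Properties as ℕP
  open import Data.Fin using (Fin)
  import Data.Fin.Properties as FinP
  open import Data.List using (List; []; _∷_; _++_; length; filter; upTo)
  import Data.List.Properties as ListP
  open import Data.Product using (Σ-syntax; _×_; _,_)
  open import Data.Sum using (_⊎_; inj₁; inj₂)
  open import Data.Sum.Function.Propositional using (_⊎-↔_)
  open import Data.Bool.Properties using (T-irrelevant)
  open import Function.Bundles using (_↔_; mk↔ₛ′)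
  open import Function.Properties.Inverse using (↔-refl; ↔-sym; ↔-trans)
  open import Relation.Binary.PropositionalEquality
    using (_≡_; refl; sym; cong; cong₂; subst; module ≡-Reasoning)
  open import Relation.Nullary using (yes; no; contradiction)
  open import Relation.Nullary.Decidable using (True)
  open import Relation.Unary using (Pred; Decidable)

  module _ {p} {P : Pred ℕ p} (P? : Decidable P) where

    -- True (P? k) rather than P k, so that Below m has no two elements with the same k.
    Below : ℕ → Set
    Below m = Σ[ k ∈ ℕ ] (k < m × True (P? k))

    Below-≡ : ∀ {m k k′} → k ≡ k′ → ∀ {k<m k′<m t t′} →
              _≡_ {A = Below m} (k , k<m , t) (k′ , k′<m , t′)
    Below-≡ refl = cong₂ (λ k<m t → _ , k<m , t) (ℕP.<-irrelevant _ _) (T-irrelevant _ _)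

    Below-suc↔ : ∀ m → Below (suc m) ↔ (Below m ⊎ True (P? m))
    Below-suc↔ m = mk↔ₛ′ to from to∘from from∘to
      where
      k≡m : ∀ {k} → k < suc m → k ≮ m → k ≡ m
      k≡m k<1+m k≮m = ℕP.≤-antisym (ℕP.≤-pred k<1+m) (ℕP.≮⇒≥ k≮m)
      to : Below (suc m) → Below m ⊎ True (P? m)
      to (k , k<1+m , t) with k <? m
      ... | yes k<m = inj₁ (k , k<m , t)
      ... | no  k≮m = inj₂ (subst (λ k → True (P? k)) (k≡m k<1+m k≮m) t)
      from : Below m ⊎ True (P? m) → Below (suc m)
      from (inj₁ (k , k<m , t)) = k , ℕP.m<n⇒m<1+n k<m , t
      from (inj₂ t)             = m , ℕP.n<1+n m , t
      to∘from : ∀ x → to (from x) ≡ x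
      to∘from (inj₁ (k , k<m , t)) with k <? m
      ... | yes _   = cong inj₁ (Below-≡ refl)
      ... | no  k≮m = contradiction k<m k≮m
      to∘from (inj₂ t) with m <? m
      ... | yes m<m = contradiction m<m (ℕP.<-irrefl refl)
      ... | no  _   = cong inj₂ (T-irrelevant _ _)
      from∘to : ∀ x → from (to x) ≡ x
      from∘to (k , k<1+m , t) with k <? m
      ... | yes _   = Below-≡ refl
      ... | no  k≮m = Below-≡ (sym (k≡m k<1+m k≮m))

    private
      Fin-filter-[m]↔ : ∀ m → Fin (length (filter P? (m ∷ []))) ↔ True (P? m)
      Fin-filter-[m]↔ m with P? m
      ... | yes _ = FinP.1↔⊤
      ... | no  _ = FinP.0↔⊥

    count-filter-upTo : ∀ m → Fin (length (filter P? (upTo m))) ↔ Below m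
    count-filter-upTo zero    = mk↔ₛ′ (λ ()) (λ ()) (λ ()) (λ ())
    count-filter-upTo (suc m) =
      ↔-trans (subst (λ n → Fin (count (upTo (suc m))) ↔ Fin n) length-split ↔-refl)
      (↔-trans FinP.+↔⊎
      (↔-trans (count-filter-upTo m ⊎-↔ Fin-filter-[m]↔ m)
      (↔-sym (Below-suc↔ m))))
      where
      count : List ℕ → ℕ
      count xs = length (filter P? xs)
      length-split : count (upTo (suc m)) ≡ count (upTo m) + count (m ∷ [])
      length-split = begin
        count (upTo (suc m))                               ≡⟨ cong count (ListP.upTo-∷ʳ m) ⟨
        count (upTo m ++ m ∷ [])                           ≡⟨ cong length (ListP.filter-++ P? (upTo m) _) ⟩
        length (filter P? (upTo m) ++ filter P? (m ∷ []))  ≡⟨ ListP.length-++ (filter P? (upTo m)) ⟩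
        count (upTo m) + count (m ∷ [])                    ∎
        where open ≡-Reasoning

module Solutions (n : ℕ) where

  open import Data.Nat as ℕ using (suc; _+_; _*_; _∸_; _≤_; s≤s)
  import Data.Nat.Properties as ℕP
  open import Data.Nat.Divisibility using (_∣_; divides; quotient)
  open _∣_ using (equality)
  open import Data.Integer as ℤ using (ℤ; +_)
  import Data.Integer.Properties as ℤP
  open import Data.Product using (Σ; _×_; _,_; proj₂)
  open import Function.Bundles using (_↔_; mk↔ₛ′)
  open import Relation.Binary.PropositionalEquality using (_≡_; refl; sym; trans; cong; subst)
  open import Relation.Nullary.Decidable using (toWitness; fromWitness)
  open import Axiom.UniquenessOfIdentityProofs using (module Decidable⇒UIP)
  open import Defs using (Q; fermatPrime?)
  open FilterCounting using (Below; Below-≡)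
  open FermatPrimeCriterion using (fermatPrime⇒divisibilities; divisibilities⇒fermatPrime)
  open QuadraticForm using (Q≡0⇒; ⇒Q≡0)

  Solution : Set
  Solution = Σ (ℕ × ℕ × ℕ × ℕ) (λ { (g , v , a , b) → Q n g v a b ≡ + 0 })

  private
    quotient-unique : ∀ {m k q} .{{_ : ℕ.NonZero m}} (m∣k : m ∣ k) → k ≡ q * m → quotient m∣k ≡ q
    quotient-unique {m} (divides q′ k≡q′m) k≡qm = ℕP.*-cancelʳ-≡ q′ _ m (trans (sym k≡q′m) k≡qm)

    Solution-≡ : ∀ {g v v′ a a′ b b′} {Q≡0 Q′≡0} → v ≡ v′ → a ≡ a′ → b ≡ b′ →
                 _≡_ {A = Solution} ((g , v , a , b) , Q≡0) ((g , v′ , a′ , b′) , Q′≡0)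
    Solution-≡ {g} {v} {a = a} {b = b} refl refl refl =
      cong ((g , v , a , b) ,_) (Decidable⇒UIP.≡-irrelevant ℤ._≟_ _ _)

  fermat-indices↔solutions : Below (λ g → fermatPrime? (6 * g + 5)) (suc n) ↔ Solution
  fermat-indices↔solutions = mk↔ₛ′ to from to∘from from∘to
    where
    to : Below _ (suc n) → Solution
    to (g , g<1+n , t) =
      let e∣12ᵉ , p∣12ᵉ+1 = fermatPrime⇒divisibilities g (toWitness t) in
      (g , n ∸ g , quotient e∣12ᵉ , quotient p∣12ᵉ+1) ,
      ⇒Q≡0 {n} {g} {n ∸ g} {quotient e∣12ᵉ} {quotient p∣12ᵉ+1}
           (ℕP.m+[n∸m]≡n (ℕP.≤-pred g<1+n)) (equality e∣12ᵉ) (equality p∣12ᵉ+1)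

    from : Solution → Below _ (suc n)
    from ((g , v , a , b) , Q≡0) =
      let g+v≡n , 12ᵉ≡ae , 12ᵉ+1≡bp = Q≡0⇒ {n} {g} {v} {a} {b} Q≡0 in
      g , s≤s (subst (g ≤_) g+v≡n (ℕP.m≤m+n g v)) ,
      fromWitness (divisibilities⇒fermatPrime g (divides a 12ᵉ≡ae) (divides b 12ᵉ+1≡bp))

    from∘to : ∀ x → from (to x) ≡ x
    from∘to x = Below-≡ _ refl

    to∘from : ∀ y → to (from y) ≡ y
    to∘from y@((g , v , a , b) , Q≡0) =
      let g+v≡n , 12ᵉ≡ae , 12ᵉ+1≡bp = Q≡0⇒ {n} {g} {v} {a} {b} Q≡0
          e∣12ᵉ , p∣12ᵉ+1 = fermatPrime⇒divisibilities g (toWitness (proj₂ (proj₂ (from y))))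
      in Solution-≡ (trans (cong (_∸ g) (sym g+v≡n)) (ℕP.m+n∸m≡n g v))
                    (quotient-unique {{ℕ.≢-nonZero (ℕP.m+1+n≢0 (3 * g))}} e∣12ᵉ 12ᵉ≡ae)
                    (quotient-unique {{ℕ.≢-nonZero (ℕP.m+1+n≢0 (6 * g))}} p∣12ᵉ+1 12ᵉ+1≡bp)

open import Data.Nat using (suc; _+_; _*_)
open import Data.Fin using (Fin)
open import Data.Integer using (+_)
open import Data.Product using (Σ; _×_; _,_)
open import Function.Bundles using (_↔_)
open import Function.Properties.Inverse using (↔-trans)
open import Relation.Binary.PropositionalEquality using (_≡_)
open import Defs using (𝓕; Q; fermatPrime?)

mainTheorem7 : (n : ℕ) →
    Fin (𝓕 n) ↔ Σ (ℕ × ℕ × ℕ × ℕ) (λ { (g , v , a , b) → Q n g v a b ≡ + 0 })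
mainTheorem7 n = ↔-trans (FilterCounting.count-filter-upTo (λ g → fermatPrime? (6 * g + 5)) (suc n))
                         (Solutions.fermat-indices↔solutions n)
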